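{- There is no closed term in normal form (with respect to $\rightsquigarrow$) of type $\tau$; that is, there is no closed term $r$ with $r:\tau$ such that no $s$ satisfies $r\rightsquigarrow s$.
   Context: Types are generated by $A ::= \tau \mid A\Rightarrow A \mid A\wedge A$, where $\tau$ is the only atomic type ($\Rightarrow$ associates to the right). Type equivalence $\equiv$ is the smallest congruence on types such that $A\wedge B\equiv B\wedge A$, $A\wedge(B\wedge C)\equiv(A\wedge B)\wedge C$, $A\Rightarrow(B\wedge C)\equiv(A\Rightarrow B)\wedge(A\Rightarrow C)$ and $(A\wedge B)\Rightarrow C\equiv A\Rightarrow B\Rightarrow C$. To each type $A$ is associated an infinite set of variables $\mathcal V_A$, with $\mathcal V_A=\mathcal V_B$ if $A\equiv B$ and $\mathcal V_A\cap\mathcal V_B=\emptyset$ otherwise. Preterms are $r ::= x \mid \lambda x.r \mid rr \mid r\times r \mid \pi_A(r)$ (application left associative); one writes $\lambda x^A.r$ for $\lambda x.r$ when $x\in\mathcal V_A$. Introductions are abstractions and products; eliminations are applications and projections. Substitution $r[s/x]$ is as usual; a term is closed if it has no free variables. Typing $r:A$ (without contexts): $x:A$ if $x\in\mathcal V_A$; if $r:A$ and $A\equiv B$ then $r:B$; if $r:B$ then $\lambda x^A.r:A\Rightarrow B$; if $r:A\Rightarrow B$ and $s:A$ then $rs:B$; if $r:A$ and $s:B$ then $r\times s:A\wedge B$; if $r:A\wedge B$ then $\pi_A(r):A$. Terms are well-typed preterms. $\rightleftarrows$ is the smallest symmetric relation, closed under all term contexts, containing $r\times s\rightleftarrows s\times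 r$, $(r\times s)\times t\rightleftarrows r\times(s\times t)$, $\lambda x^A.(r\times s)\rightleftarrows \lambda x^A.r\times\lambda x^A.s$, $rst\rightleftarrows r(s\times t)$; $\rightleftarrows^*$ is its reflexive transitive closure. Reduction: $\to_{\beta\pi\zeta}$: if $s:A$ then $(\lambda x^A.r)s\to_{\beta\pi\zeta} r[s/x]$; if $r:A$ then $\pi_A(r\times s)\to_{\beta\pi\zeta} r$; $(r\times s)t\to_{\beta\pi\zeta} rt\times st$. $\to_{\eta\delta}$: if $r:A\Rightarrow B$, $r$ is an elimination or a variable, and $x\in\mathcal V_A$ fresh, then $r\to_{\eta\delta}\lambda x^A.(rx)$; if $r:A\wedge B$ and $r$ is an elimination or a variable, then $r\to_{\eta\delta}\pi_A(r)\times\pi_B(r)$. The relations $\hookrightarrow$ and $\to$ are the smallest relations such that: $r\to_{\beta\pi\zeta}s$ implies $r\hookrightarrow s$; $r\to_{\eta\delta}s$ implies $r\to s$; $r\hookrightarrow s$ implies $r\to s$; $r\to s$ implies $\lambda x.r\hookrightarrow\lambda x.s$; $r\hookrightarrow s$ implies $rt\hookrightarrow st$; $r\to s$ implies $tr\hookrightarrow ts$, $r\times t\hookrightarrow s\times t$, $t\times r\hookrightarrow t\times s$; $r\hookrightarrow s$ implies $\pi_A(r)\hookrightarrow\pi_A(s)$. Finally $r\rightsquigarrow s$ iff $r\rightleftarrows^* r'\to s'\rightleftarrows^* s$ for some $r',s'$. -}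

module Defs where

open import Data.Nat using (ℕ; zero; suc)
open import Data.List using (List; []; _∷_)
open import Data.Product using (Σ; ∃; _×_; _,_)
open import Relation.Binary.Construct.Closure.ReflexiveTransitive using (Star)

infixr 7 _⇒_
infixr 8 _∧_

data Ty : Set where
  τ   : Ty
  _⇒_ : Ty → Ty → Ty
  _∧_ : Ty → Ty → Ty

infix 4 _≡ₜ_
data _≡ₜ_ : Ty → Ty → Set where
  ≡ₜ-refl  : ∀ {A} → A ≡ₜ A
  ≡ₜ-sym   : ∀ {A B} → A ≡ₜ B → B ≡ₜ A
  ≡ₜ-trans : ∀ {A B C} → A ≡ₜ B → B ≡ₜ C → A ≡ₜ C
  ≡ₜ-⇒     : ∀ {A A' B B'} → A ≡ₜ A' → B ≡ₜ B' → A ⇒ B ≡ₜ A' ⇒ B'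
  ≡ₜ-∧     : ∀ {A A' B B'} → A ≡ₜ A' → B ≡ₜ B' → A ∧ B ≡ₜ A' ∧ B'
  ≡ₜ-comm  : ∀ {A B} → A ∧ B ≡ₜ B ∧ A
  ≡ₜ-assoc : ∀ {A B C} → A ∧ (B ∧ C) ≡ₜ (A ∧ B) ∧ C
  ≡ₜ-dist  : ∀ {A B C} → A ⇒ (B ∧ C) ≡ₜ (A ⇒ B) ∧ (A ⇒ C)
  ≡ₜ-curry : ∀ {A B C} → (A ∧ B) ⇒ C ≡ₜ A ⇒ B ⇒ C

-- Preterms, in de Bruijn notation (terms up to α-equivalence).
-- A binder λx^A is written  lam A r ; the variable x bound by it is a
-- de Bruijn index, and lives in 𝒱_A.

data Tm : Set where
  var  : ℕ → Tm
  lam  : Ty → Tm → Tm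
  app  : Tm → Tm → Tm
  pair : Tm → Tm → Tm
  proj : Ty → Tm → Tm

shiftVar : ℕ → ℕ → ℕ
shiftVar zero    i       = suc i
shiftVar (suc c) zero    = zero
shiftVar (suc c) (suc i) = suc (shiftVar c i)

shift : ℕ → Tm → Tm
shift c (var i)    = var (shiftVar c i)
shift c (lam A r)  = lam A (shift (suc c) r)
shift c (app r s)  = app (shift c r) (shift c s)
shift c (pair r s) = pair (shift c r) (shift c s)
shift c (proj A r) = proj A (shift c r)

-- capture-avoiding substitution  r[s/j]  (index j removed)
substVar : ℕ → ℕ → Tm → Tm
substVar zero    zero    s = s
substVar zero    (suc i) s = var i
substVar (suc j) zero    s = var zero
substVar (suc j) (suc i) s = shift zero (substVar j i s)

subst : ℕ → Tm → Tm → Tm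
subst j s (var i)    = substVar j i s
subst j s (lam A r)  = lam A (subst (suc j) s r)
subst j s (app r t)  = app (subst j s r) (subst j s t)
subst j s (pair r t) = pair (subst j s r) (subst j s t)
subst j s (proj A r) = proj A (subst j s r)

_[_/0] : Tm → Tm → Tm
r [ s /0] = subst zero s r

-- Typing.  The context Γ lists the annotations of enclosing binders
-- (it replaces the global assignment of variables to the sets 𝒱_A).

Ctx : Set
Ctx = List Ty

infix 4 _∋_∶_ _⊢_∶_
data _∋_∶_ : Ctx → ℕ → Ty → Set where
  here  : ∀ {Γ A} → (A ∷ Γ) ∋ zero ∶ A
  there : ∀ {Γ A B i} → Γ ∋ i ∶ A → (B ∷ Γ) ∋ suc i ∶ A

data _⊢_∶_ (Γ : Ctx) : Tm → Ty → Set where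
  t-var  : ∀ {i A} → Γ ∋ i ∶ A → Γ ⊢ var i ∶ A
  t-conv : ∀ {r A B} → Γ ⊢ r ∶ A → A ≡ₜ B → Γ ⊢ r ∶ B
  t-lam  : ∀ {r A B} → (A ∷ Γ) ⊢ r ∶ B → Γ ⊢ lam A r ∶ A ⇒ B
  t-app  : ∀ {r s A B} → Γ ⊢ r ∶ A ⇒ B → Γ ⊢ s ∶ A → Γ ⊢ app r s ∶ B
  t-pair : ∀ {r s A B} → Γ ⊢ r ∶ A → Γ ⊢ s ∶ B → Γ ⊢ pair r s ∶ A ∧ B
  t-proj : ∀ {r A B} → Γ ⊢ r ∶ A ∧ B → Γ ⊢ proj A r ∶ A

infix 4 _⇄ₐ_ _⇄_ _⇄*_
data _⇄ₐ_ : Tm → Tm → Set where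
  ax-comm  : ∀ {r s} → pair r s ⇄ₐ pair s r
  ax-assoc : ∀ {r s t} → pair (pair r s) t ⇄ₐ pair r (pair s t)
  ax-dist  : ∀ {A r s} → lam A (pair r s) ⇄ₐ pair (lam A r) (lam A s)
  ax-curry : ∀ {r s t} → app (app r s) t ⇄ₐ app r (pair s t)

data _⇄_ : Tm → Tm → Set where
  ⇄-ax    : ∀ {r s} → r ⇄ₐ s → r ⇄ s
  ⇄-axsym : ∀ {r s} → r ⇄ₐ s → s ⇄ r
  ⇄-lam   : ∀ {A r s} → r ⇄ s → lam A r ⇄ lam A s
  ⇄-appl  : ∀ {r s t} → r ⇄ s → app r t ⇄ app s t
  ⇄-appr  : ∀ {r s t} → r ⇄ s → app t r ⇄ app t s
  ⇄-pairl : ∀ {r s t} → r ⇄ s → pair r t ⇄ pair s t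
  ⇄-pairr : ∀ {r s t} → r ⇄ s → pair t r ⇄ pair t s
  ⇄-proj  : ∀ {A r s} → r ⇄ s → proj A r ⇄ proj A s

_⇄*_ : Tm → Tm → Set
_⇄*_ = Star _⇄_

data ElimOrVar : Tm → Set where
  ev-var  : ∀ {i} → ElimOrVar (var i)
  ev-app  : ∀ {r s} → ElimOrVar (app r s)
  ev-proj : ∀ {A r} → ElimOrVar (proj A r)

infix 4 _⊢_→βπζ_ _⊢_→ηδ_ _⊢_↪_ _⊢_⟶_ _⊢_⇝_

data _⊢_→βπζ_ (Γ : Ctx) : Tm → Tm → Set where
  β : ∀ {A r s} → Γ ⊢ s ∶ A → Γ ⊢ app (lam A r) s →βπζ (r [ s /0])
  π : ∀ {A r s} → Γ ⊢ r ∶ A → Γ ⊢ proj A (pair r s) →βπζ r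
  ζ : ∀ {r s t} → Γ ⊢ app (pair r s) t →βπζ pair (app r t) (app s t)

data _⊢_→ηδ_ (Γ : Ctx) : Tm → Tm → Set where
  η : ∀ {A B r} → Γ ⊢ r ∶ A ⇒ B → ElimOrVar r →
      Γ ⊢ r →ηδ lam A (app (shift zero r) (var zero))
  δ : ∀ {A B r} → Γ ⊢ r ∶ A ∧ B → ElimOrVar r →
      Γ ⊢ r →ηδ pair (proj A r) (proj B r)

mutual
  data _⊢_↪_ (Γ : Ctx) : Tm → Tm → Set where
    ↪-βπζ  : ∀ {r s} → Γ ⊢ r →βπζ s → Γ ⊢ r ↪ s
    ↪-lam  : ∀ {A r s} → (A ∷ Γ) ⊢ r ⟶ s → Γ ⊢ lam A r ↪ lam A s
    ↪-appl : ∀ {r s t} → Γ ⊢ r ↪ s → Γ ⊢ app r t ↪ app s t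
    ↪-appr : ∀ {r s t} → Γ ⊢ r ⟶ s → Γ ⊢ app t r ↪ app t s
    ↪-pairl : ∀ {r s t} → Γ ⊢ r ⟶ s → Γ ⊢ pair r t ↪ pair s t
    ↪-pairr : ∀ {r s t} → Γ ⊢ r ⟶ s → Γ ⊢ pair t r ↪ pair t s
    ↪-proj : ∀ {A r s} → Γ ⊢ r ↪ s → Γ ⊢ proj A r ↪ proj A s

  data _⊢_⟶_ (Γ : Ctx) : Tm → Tm → Set where
    ⟶-ηδ : ∀ {r s} → Γ ⊢ r →ηδ s → Γ ⊢ r ⟶ s
    ⟶-↪  : ∀ {r s} → Γ ⊢ r ↪ s → Γ ⊢ r ⟶ s

_⊢_⇝_ : Ctx → Tm → Tm → Set
Γ ⊢ r ⇝ s = Σ Tm λ r' → Σ Tm λ s' → (r ⇄* r') × (Γ ⊢ r' ⟶ s') × (s' ⇄* s)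

module Submission where

-- We prove the stronger fact that there is no closed term of type τ at
-- all, normal or not, by a set-theoretic (Tarskian) model of the type
-- system.  Interpret the atom τ as an arbitrary set X, implication as the
-- function space and conjunction as the cartesian product.  The four
-- axioms of type equivalence (commutativity and associativity of ∧,
-- distributivity of ⇒ over ∧, currying) hold in this model up to logical
-- equivalence, hence so does their congruence closure ≡ₜ.  It follows that
-- every term typed in a context Γ denotes an element of its type once an
-- element is chosen for each type in Γ (soundness).  A closed term of
-- type τ would thus denote an element of X for every X; taking X empty
-- gives a contradiction.

open import Defs
open import Data.Empty using (⊥)
open import Data.List using ([])
open import Data.List.Relation.Unary.All using (All; []; _∷_)
open import Data.Product using (Σ; ∃; _×_; _,_; proj₁; proj₂; swap; curry; uncurry)
open import Data.Product.Function.NonDependent.Propositional using (_×-⇔_)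
open import Function.Bundles using (_⇔_; mk⇔; Equivalence)
open import Function.Properties.Equivalence using () renaming (refl to ⇔-refl; sym to ⇔-sym; trans to ⇔-trans)
open import Function.Related.TypeIsomorphisms using (→-cong-⇔)
open import Relation.Nullary using (¬_)

module Model (X : Set) where

  ⟦_⟧ : Ty → Set
  ⟦ τ ⟧     = X
  ⟦ A ⇒ B ⟧ = ⟦ A ⟧ → ⟦ B ⟧
  ⟦ A ∧ B ⟧ = ⟦ A ⟧ × ⟦ B ⟧

  ≡ₜ-sound : ∀ {A B} → A ≡ₜ B → ⟦ A ⟧ ⇔ ⟦ B ⟧
  ≡ₜ-sound ≡ₜ-refl          = ⇔-refl
  ≡ₜ-sound (≡ₜ-sym e)       = ⇔-sym (≡ₜ-sound e)
  ≡ₜ-sound (≡ₜ-trans e f)   = ⇔-trans (≡ₜ-sound e) (≡ₜ-sound f)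
  ≡ₜ-sound (≡ₜ-⇒ e f)       = →-cong-⇔ (≡ₜ-sound e) (≡ₜ-sound f)
  ≡ₜ-sound (≡ₜ-∧ e f)       = ≡ₜ-sound e ×-⇔ ≡ₜ-sound f
  ≡ₜ-sound ≡ₜ-comm          = mk⇔ swap swap
  ≡ₜ-sound ≡ₜ-assoc         =
    mk⇔ (λ { (a , (b , c)) → (a , b) , c }) (λ { ((a , b) , c) → a , (b , c) })
  ≡ₜ-sound ≡ₜ-dist          =
    mk⇔ (λ f → (λ x → proj₁ (f x)) , (λ x → proj₂ (f x)))
        (λ { (f , g) x → f x , g x })
  ≡ₜ-sound ≡ₜ-curry         = mk⇔ curry uncurry

  Env : Ctx → Set
  Env = All ⟦_⟧

  lookup : ∀ {Γ i A} → Γ ∋ i ∶ A → Env Γ → ⟦ A ⟧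
  lookup here      (x ∷ _) = x
  lookup (there p) (_ ∷ ρ) = lookup p ρ

  ⟦_⟧⊢ : ∀ {Γ r A} → Γ ⊢ r ∶ A → Env Γ → ⟦ A ⟧
  ⟦ t-var p    ⟧⊢ ρ = lookup p ρ
  ⟦ t-conv d e ⟧⊢ ρ = Equivalence.to (≡ₜ-sound e) (⟦ d ⟧⊢ ρ)
  ⟦ t-lam d    ⟧⊢ ρ = λ x → ⟦ d ⟧⊢ (x ∷ ρ)
  ⟦ t-app d e  ⟧⊢ ρ = ⟦ d ⟧⊢ ρ (⟦ e ⟧⊢ ρ)
  ⟦ t-pair d e ⟧⊢ ρ = ⟦ d ⟧⊢ ρ , ⟦ e ⟧⊢ ρ
  ⟦ t-proj d   ⟧⊢ ρ = proj₁ (⟦ d ⟧⊢ ρ)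

  closed-sound : ∀ {r A} → [] ⊢ r ∶ A → ⟦ A ⟧
  closed-sound d = ⟦ d ⟧⊢ []

no-closed-term-of-type-τ : ∀ {r} → ¬ ([] ⊢ r ∶ τ)
no-closed-term-of-type-τ = Model.closed-sound ⊥

mainTheorem3 : ¬ (Σ Tm λ r → ([] ⊢ r ∶ τ) × (¬ (∃ λ s → [] ⊢ r ⇝ s)))
mainTheorem3 (_ , r∶τ , _) = no-closed-term-of-type-τ r∶τ
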